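{- There is an absolute constant $c>0$ such that the following holds. Let $G = C(m_1,\dots,m_n)$ be a caterpillar with $m = m_1+\dots+m_n$ leg vertices, let $S$ be a binary search tree on the spine vertices and $\pi$ an ordering of the leg vertices, and let $T = A(S,\pi)$. Then there is a sequence of at most $c\,(n + (H(G)+1)\, m)$ rotations transforming $T$ into a search tree on $G$ without free leg nodes.
   Context: For $n \in \mathbb{N}_+$ and $m_1,\dots,m_n \in \mathbb{N}_0$, the caterpillar $C(m_1,\dots,m_n)$ is the tree with spine vertices $s_1,\dots,s_n$ forming a path in this order, and for each $i\in[n]$, $j\in[m_i]$ a leg vertex $\ell_{i,j}$ adjacent only to $s_i$. Its leg entropy is $H(G) = \sum_{i\in[n],\,m_i>0} \frac{m_i}{m}\log_2\frac{m}{m_i}$ ($0$ if $m=0$). A search tree on a connected graph $G$ (STG) is a rooted tree $T$ with $V(T)=V(G)$ such that, if $r$ is the root with children $c_1,\dots,c_k$, then $G\setminus r$ has exactly $k$ connected components $C_1,\dots,C_k$ with $V(T_{c_i}) = V(C_i)$ and $T_{c_i}$ a search tree on $C_i$ ($T_x$ denotes the subtree of $x$ and its descendants). A rotation of an edge $(p,c)$ of $T$, $c$ a child of $p$, produces the STG in which $c$ takes the place of $p$ (child of the former parent of $p$, or root), $p$ becomes a child of $c$, each child $x$ of $c$ such that $V(T_x)$ contains a vertex adjacent in $G$ to $p$ becomes a child of $p$, and all other parent–child relations are unchanged. Projection: if $v$ is a leaf of $G$, pruning $v$ from $T$ removes $v$ and attaches its (at most one) child to the former parent of $v$ (or makes it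 the root). For connected $U$, $T[U]$ results from repeatedly pruning the vertices outside $U$. The spine BST $\mathrm{bst}(T)$ is $T[\{s_1,\dots,s_n\}]$, viewed as a BST with key order $s_1<\dots<s_n$. A leg node is bound if it has no children in the search tree, and free otherwise. $A(S,\pi)$ is the unique search tree on $G$ with $\mathrm{bst}(A(S,\pi))=S$ in which all leg nodes are ancestors of all spine nodes (forming a path at the top), ordered from bottom to top according to $\pi$. -}

module Defs where

open import Data.Nat using (ℕ; zero; suc; _+_; _*_; _^_; _≤_)
open import Data.Fin using (Fin; toℕ)
open import Data.List using (List; []; _∷_; _++_; [_]; allFin; map; concatMap)
open import Data.Nat.ListAction using (sum; product)
open import Data.List.Membership.Propositional using (_∈_; _∉_)
open import Data.List.Relation.Unary.All using (All)
open import Data.List.Relation.Unary.AllPairs using (AllPairs)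
open import Data.List.Relation.Binary.Permutation.Propositional using (_↭_)
open import Data.Product using (Σ; ∃; _×_)
open import Relation.Binary.PropositionalEquality using (_≡_; _≢_)
open import Relation.Nullary using (¬_)

-- Rooted trees with a list of children (order of children is irrelevant
-- for all notions below except where explicitly handled by permutations).
data RTree (A : Set) : Set where
  node : A → List (RTree A) → RTree A

module _ {A : Set} where
  mutual
    verts : RTree A → List A
    verts (node x cs) = x ∷ vertsF cs

    vertsF : List (RTree A) → List A
    vertsF [] = []
    vertsF (c ∷ cs) = verts c ++ vertsF cs

data BT (n : ℕ) : Set where
  lf : BT n
  br : BT n → Fin n → BT n → BT n

inorder : ∀ {n} → BT n → List (Fin n)
inorder lf = []
inorder (br l k r) = inorder l ++ k ∷ inorder r

IsBST : ∀ {n} → BT n → Set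
IsBST {n} S = inorder S ≡ allFin n

-- The caterpillar C(m_1,…,m_n): spine vertex i (i : Fin n) is s_{i+1};
-- leg vertex (i , j) is ℓ_{i+1,j+1}.
module Cat (n : ℕ) (ms : Fin n → ℕ) where

  data V : Set where
    spine : Fin n → V
    leg   : (i : Fin n) → Fin (ms i) → V

  data Adj : V → V → Set where
    ss  : ∀ {i j} → toℕ j ≡ suc (toℕ i) → Adj (spine i) (spine j)
    ss' : ∀ {i j} → toℕ i ≡ suc (toℕ j) → Adj (spine i) (spine j)
    sl  : ∀ {i j} → Adj (spine i) (leg i j)
    ls  : ∀ {i j} → Adj (leg i j) (spine i)

  m : ℕ
  m = sum (map ms (allFin n))

  allLegs : List V
  allLegs = concatMap (λ i → map (leg i) (allFin (ms i))) (allFin n)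

  data Conn (C : V → Set) : V → V → Set where
    here : ∀ {u} → Conn C u u
    step : ∀ {u w v} → Adj u w → C w → Conn C w v → Conn C u v

  IsComponent : (V → Set) → (V → Set) → Set
  IsComponent U C =
    (∀ v → C v → U v) ×
    (∃ λ v → C v) ×
    (∀ u v → C u → C v → Conn C u v) ×
    (∀ u v → C u → U v → Adj u v → C v)

  Disjoint : RTree V → RTree V → Set
  Disjoint c d = ∀ v → v ∈ verts c → v ∉ verts d

  data IsST : RTree V → Set where
    st : ∀ {r cs} →
         All (λ c → IsComponent (λ v → (v ∈ verts (node r cs)) × (v ≢ r))
                                (λ v → v ∈ verts c)) cs →
         AllPairs Disjoint cs →
         All IsST cs →
         IsST (node r cs)

  IsSTG : RTree V → Set
  IsSTG T = IsST T × (∀ v → v ∈ verts T)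

  Touches : V → RTree V → Set
  Touches p x = ∃ λ v → (v ∈ verts x) × Adj v p

  data Rot : RTree V → RTree V → Set where
    top  : ∀ {p c pre post ds moved stay ps' cs'} →
           ds ↭ moved ++ stay →
           All (Touches p) moved →
           All (λ x → ¬ Touches p x) stay →
           ps' ↭ pre ++ moved ++ post →
           cs' ↭ node p ps' ∷ stay →
           Rot (node p (pre ++ node c ds ∷ post)) (node c cs')
    down : ∀ {r pre post t t'} → Rot t t' →
           Rot (node r (pre ++ t ∷ post)) (node r (pre ++ t' ∷ post))

  data Rots : ℕ → RTree V → RTree V → Set where
    done : ∀ {t} → Rots zero t t
    more : ∀ {k t u w} → Rot t u → Rots k u w → Rots (suc k) t w

  data NoFree : RTree V → Set where
    spineN : ∀ {i cs} → All NoFree cs → NoFree (node (spine i) cs)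
    legN   : ∀ {i j} → NoFree (node (leg i j) [])

  bstTree : BT n → List (RTree V)
  bstTree lf = []
  bstTree (br l k r) = [ node (spine k) (bstTree l ++ bstTree r) ]

  -- put the legs of the list on top as a path, first element at the bottom
  legPath : List V → List (RTree V) → List (RTree V)
  legPath [] f = f
  legPath (x ∷ xs) f = legPath xs [ node x f ]

  -- A(S, π) (as a one-element list when n ≥ 1)
  A : BT n → List V → List (RTree V)
  A S π = legPath π (bstTree S)

  -- k ≤ c (n + (H(G)+1) m), written without logarithms:
  -- (H+1) m = m + m log₂ m − Σ m_i log₂ m_i, so the inequality is equivalent to
  -- 2^k · Π_i m_i^(c m_i) ≤ 2^(c (n + m)) · m^(c m)   (with 0^0 = 1).
  WithinBound : ℕ → ℕ → Set
  WithinBound c k =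
    2 ^ k * product (map (λ i → ms i ^ (c * ms i)) (allFin n))
      ≤ 2 ^ (c * (n + m)) * m ^ (c * m)

-- The spine is first rotated, in at most 2n rotations through a right path, into a
-- weight-balanced BST W, where a spine vertex s_i has depth d_i with 2^(d_i) m_i ≤ m.
-- The legs, still a path on top, are then rotated down one at a time, starting from
-- the lowest; a leg of s_i stops as a leaf child of s_i after 1 + d_i rotations.
-- The total cost is at most 2n + Σ m_i (1 + d_i), and Σ m_i d_i ≤ Σ m_i log₂(m/m_i) = m H(G).
module Submission where

open import Defs
open import Data.Nat using (ℕ; zero; suc; _+_; _*_; _^_; _∸_; _≤_; _<_; _≤?_; _<?_; z≤n; s≤s)
open import Data.Nat.Properties
open import Data.Nat.ListAction using (sum; product)
open import Data.Nat.ListAction.Properties using (sum-++; sum-↭)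
open import Data.Nat.Tactic.RingSolver using (solve-∀)
open import Data.Fin using (Fin; toℕ; fromℕ<) renaming (zero to fzero; suc to fsuc)
open import Data.Fin.Properties using (toℕ-injective; toℕ<n; toℕ-fromℕ<; fromℕ<-toℕ) renaming (_≟_ to _≟ᶠ_)
open import Data.List using (List; []; _∷_; _++_; [_]; map; length; tabulate; allFin; concatMap; filter; reverse; _ʳ++_)
open import Data.List.Properties
  using (++-assoc; ++-identityʳ; length-++; length-tabulate; map-tabulate; map-++; map-∘;
         filter-accept; filter-reject; ∷-injectiveˡ)
open import Data.List.Membership.Propositional using (_∈_)
open import Data.List.Membership.Propositional.Properties
  using (∈-++⁺ˡ; ∈-++⁺ʳ; ∈-++⁻; ∈-map⁺; ∈-map⁻; ∈-filter⁺; ∈-filter⁻; ∈-concatMap⁺; ∈-concatMap⁻; ∈-allFin)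
import Data.List.Relation.Unary.Any as Any
open import Data.List.Relation.Unary.Any using (here; there)
import Data.List.Relation.Unary.All as All
open import Data.List.Relation.Unary.All using (All; []; _∷_)
import Data.List.Relation.Unary.All.Properties as AllP
import Data.List.Relation.Unary.AllPairs as AllPairs
open import Data.List.Relation.Unary.AllPairs using (AllPairs; []; _∷_)
import Data.List.Relation.Unary.AllPairs.Properties as AllPairsP
open import Data.List.Relation.Unary.Unique.Propositional using (Unique)
import Data.List.Relation.Unary.Unique.Propositional.Properties as UniqueP
open import Data.List.Relation.Binary.Permutation.Propositional using (_↭_; ↭-refl; ↭-sym; ↭-trans; ↭-reflexive; ↭⇒↭ₛ)
open import Data.List.Relation.Binary.Permutation.Propositional.Properties using (shift; ∷↭∷ʳ; ++-comm; ∈-resp-↭)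
import Data.List.Relation.Binary.Permutation.Propositional.Properties as PermP
import Data.List.Relation.Binary.Permutation.Setoid.Properties as PermSetoid
open import Data.Product using (Σ; ∃; ∃₂; _×_; _,_; proj₁; proj₂)
open import Data.Sum using (_⊎_; inj₁; inj₂) renaming ([_,_] to [_,_]′)
open import Data.Empty using (⊥-elim)
open import Function using (_∘_)
open import Relation.Nullary using (¬_; Dec; yes; no)
open import Relation.Binary.PropositionalEquality using (_≡_; _≢_; refl; sym; trans; cong; cong₂; subst; subst₂; setoid; module ≡-Reasoning)
open import Relation.Binary.Definitions using (tri<; tri≈; tri>)

module _ {A : Set} where

  vertsF-++ : ∀ (xs ys : List (RTree A)) → vertsF (xs ++ ys) ≡ vertsF xs ++ vertsF ys
  vertsF-++ [] ys = refl
  vertsF-++ (x ∷ xs) ys = trans (cong (verts x ++_) (vertsF-++ xs ys)) (sym (++-assoc (verts x) (vertsF xs) (vertsF ys)))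

  ∈-vertsF⁺ : ∀ {v x} {xs : List (RTree A)} → x ∈ xs → v ∈ verts x → v ∈ vertsF xs
  ∈-vertsF⁺ (here refl) v∈x = ∈-++⁺ˡ v∈x
  ∈-vertsF⁺ {xs = x ∷ _} (there x∈xs) v∈x = ∈-++⁺ʳ (verts x) (∈-vertsF⁺ x∈xs v∈x)

  ∈-vertsF-[]⁺ : ∀ {v} {x : RTree A} → v ∈ verts x → v ∈ vertsF [ x ]
  ∈-vertsF-[]⁺ = ∈-++⁺ˡ

  ∈-vertsF-[]⁻ : ∀ {v} {x : RTree A} → v ∈ vertsF [ x ] → v ∈ verts x
  ∈-vertsF-[]⁻ {x = x} v∈x with ∈-++⁻ (verts x) v∈x
  ... | inj₁ v∈x′ = v∈x′
  ... | inj₂ ()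

  leaf : A → RTree A
  leaf v = node v []

  vertsF-leaves : ∀ xs → vertsF (map leaf xs) ≡ xs
  vertsF-leaves [] = refl
  vertsF-leaves (x ∷ xs) = cong (x ∷_) (vertsF-leaves xs)

^-distribʳ-* : ∀ a b e → (a * b) ^ e ≡ a ^ e * b ^ e
^-distribʳ-* a b zero = refl
^-distribʳ-* a b (suc e) = trans (cong (a * b *_) (^-distribʳ-* a b e)) (swap a b (a ^ e) (b ^ e))
  where
  swap : ∀ a b c d → (a * b) * (c * d) ≡ (a * c) * (b * d)
  swap = solve-∀

module _ {n : ℕ} where

  InRange : ℕ → ℕ → Fin n → Set
  InRange a b q = a ≤ toℕ q × toℕ q < b

  InRange-empty : ∀ {a q} → ¬ InRange a a q
  InRange-empty (a≤q , q<a) = <⇒≱ q<a a≤q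

  data Spans : ℕ → ℕ → BT n → Set where
    spans-lf : ∀ {a} → Spans a a lf
    spans-br : ∀ {a b l k r} → Spans a (toℕ k) l → Spans (suc (toℕ k)) b r → Spans a b (br l k r)

  Spans⇒≤ : ∀ {a b t} → Spans a b t → a ≤ b
  Spans⇒≤ spans-lf = ≤-refl
  Spans⇒≤ (spans-br sl sr) = ≤-trans (Spans⇒≤ sl) (≤-trans (n≤1+n _) (Spans⇒≤ sr))

  Spans-lf⇒≡ : ∀ {a b} → Spans a b lf → a ≡ b
  Spans-lf⇒≡ spans-lf = refl

  InRange-lf : ∀ {a b q} → Spans a b lf → ¬ InRange a b q
  InRange-lf spans-lf = InRange-empty

  Spans-br⇒< : ∀ {a b l k r} → Spans a b (br l k r) → a < b
  Spans-br⇒< (spans-br sl sr) = ≤-<-trans (Spans⇒≤ sl) (Spans⇒≤ sr)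

  InRange-root : ∀ {a b l k r} → Spans a b (br l k r) → InRange a b k
  InRange-root (spans-br sl sr) = Spans⇒≤ sl , Spans⇒≤ sr

  InRange-left : ∀ {a b l k r q} → Spans a b (br l k r) → InRange a (toℕ k) q → InRange a b q
  InRange-left (spans-br _ sr) (a≤q , q<k) = a≤q , <-trans q<k (Spans⇒≤ sr)

  InRange-right : ∀ {a b l k r q} → Spans a b (br l k r) → InRange (suc (toℕ k)) b q → InRange a b q
  InRange-right (spans-br sl _) (k<q , q<b) = ≤-trans (≤-trans (Spans⇒≤ sl) (n≤1+n _)) k<q , q<b

  depth : ℕ → BT n → ℕ
  depth q lf = 0
  depth q (br l k r) with <-cmp q (toℕ k)
  ... | tri< _ _ _ = suc (depth q l)
  ... | tri≈ _ _ _ = 0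
  ... | tri> _ _ _ = suc (depth q r)

  data BSTRot : BT n → BT n → Set where
    rotateRight : ∀ {a x b y c} → BSTRot (br (br a x b) y c) (br a x (br b y c))
    rotateLeft  : ∀ {a x b y c} → BSTRot (br a x (br b y c)) (br (br a x b) y c)
    inLeft      : ∀ {l l' k r} → BSTRot l l' → BSTRot (br l k r) (br l' k r)
    inRight     : ∀ {l k r r'} → BSTRot r r' → BSTRot (br l k r) (br l k r')

  BSTRot-sym : ∀ {t u} → BSTRot t u → BSTRot u t
  BSTRot-sym rotateRight = rotateLeft
  BSTRot-sym rotateLeft = rotateRight
  BSTRot-sym (inLeft p) = inLeft (BSTRot-sym p)
  BSTRot-sym (inRight p) = inRight (BSTRot-sym p)

  Spans-BSTRot : ∀ {a b t u} → Spans a b t → BSTRot t u → Spans a b u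
  Spans-BSTRot (spans-br (spans-br sa sb) sc) rotateRight = spans-br sa (spans-br sb sc)
  Spans-BSTRot (spans-br sa (spans-br sb sc)) rotateLeft = spans-br (spans-br sa sb) sc
  Spans-BSTRot (spans-br sl sr) (inLeft p) = spans-br (Spans-BSTRot sl p) sr
  Spans-BSTRot (spans-br sl sr) (inRight p) = spans-br sl (Spans-BSTRot sr p)

  infixr 5 _◅_ _◅◅_

  data BSTRots : ℕ → BT n → BT n → Set where
    ε   : ∀ {t} → BSTRots zero t t
    _◅_ : ∀ {k t u w} → BSTRot t u → BSTRots k u w → BSTRots (suc k) t w

  _◅◅_ : ∀ {k k' t u w} → BSTRots k t u → BSTRots k' u w → BSTRots (k + k') t w
  ε ◅◅ qs = qs
  (p ◅ ps) ◅◅ qs = p ◅ (ps ◅◅ qs)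

  BSTRots-snoc : ∀ {k t u w} → BSTRots k t u → BSTRot u w → BSTRots (suc k) t w
  BSTRots-snoc ε q = q ◅ ε
  BSTRots-snoc (p ◅ ps) q = p ◅ BSTRots-snoc ps q

  BSTRots-reverse : ∀ {k t u} → BSTRots k t u → BSTRots k u t
  BSTRots-reverse ε = ε
  BSTRots-reverse (p ◅ ps) = BSTRots-snoc (BSTRots-reverse ps) (BSTRot-sym p)

  BSTRots-inRight : ∀ {k l x r r'} → BSTRots k r r' → BSTRots k (br l x r) (br l x r')
  BSTRots-inRight ε = ε
  BSTRots-inRight (p ◅ ps) = inRight p ◅ BSTRots-inRight ps

  Spans-BSTRots : ∀ {a b k t u} → Spans a b t → BSTRots k t u → Spans a b u
  Spans-BSTRots s ε = s
  Spans-BSTRots s (p ◅ ps) = Spans-BSTRots (Spans-BSTRot s p) ps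

  size : BT n → ℕ
  size lf = 0
  size (br l k r) = suc (size l + size r)

  offRightSpine : BT n → ℕ
  offRightSpine lf = 0
  offRightSpine (br l k r) = size l + offRightSpine r

  offRightSpine≤size : ∀ t → offRightSpine t ≤ size t
  offRightSpine≤size lf = z≤n
  offRightSpine≤size (br l k r) = ≤-trans (+-monoʳ-≤ (size l) (offRightSpine≤size r)) (n≤1+n _)

  Spans-size : ∀ {a b t} → Spans a b t → a + size t ≡ b
  Spans-size {a} spans-lf = +-identityʳ a
  Spans-size {a} (spans-br {l = l} {r = r} sl sr) = begin
    a + suc (size l + size r)  ≡⟨ +-suc a _ ⟩
    suc (a + (size l + size r)) ≡⟨ cong suc (+-assoc a (size l) (size r)) ⟨
    suc (a + size l + size r)   ≡⟨ cong (λ z → suc z + size r) (Spans-size sl) ⟩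
    suc (toℕ _) + size r        ≡⟨ Spans-size sr ⟩
    _                           ∎
    where open ≡-Reasoning

  offRightSpine-≤ : ∀ {b t} → Spans 0 b t → offRightSpine t ≤ b
  offRightSpine-≤ {t = t} s = ≤-trans (offRightSpine≤size t) (≤-reflexive (Spans-size s))

  data RightPath : BT n → Set where
    path-lf : RightPath lf
    path-br : ∀ {k r} → RightPath r → RightPath (br lf k r)

  -- Every right rotation at the root decreases offRightSpine by one.
  toRightPath : ∀ t → ∃ λ p → RightPath p × BSTRots (offRightSpine t) t p
  toRightPath t = go _ t refl
    where
    go : ∀ N t → offRightSpine t ≡ N → ∃ λ p → RightPath p × BSTRots N t p
    go N lf refl = lf , path-lf , ε
    go N (br lf k r) e with go N r e
    ... | p , rp , ps = br lf k p , path-br rp , BSTRots-inRight ps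
    go (suc N) (br (br l₁ k₁ r₁) k r) e =
      let p , rp , ps = go N (br l₁ k₁ (br r₁ k r)) (trans (sym (+-assoc (size l₁) (size r₁) (offRightSpine r))) (suc-injective e))
      in p , rp , rotateRight ◅ ps

  RightPath-unique : ∀ {a b p p'} → Spans a b p → Spans a b p' → RightPath p → RightPath p' → p ≡ p'
  RightPath-unique spans-lf spans-lf path-lf path-lf = refl
  RightPath-unique spans-lf s path-lf (path-br _) = ⊥-elim (<-irrefl refl (Spans-br⇒< s))
  RightPath-unique s spans-lf (path-br _) path-lf = ⊥-elim (<-irrefl refl (Spans-br⇒< s))
  RightPath-unique (spans-br {k = k} sl sr) (spans-br {k = k'} sl' sr') (path-br rp) (path-br rp')
    with toℕ-injective {i = k} {j = k'} (trans (sym (Spans-lf⇒≡ sl)) (Spans-lf⇒≡ sl'))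
  ... | refl = cong (br lf k) (RightPath-unique sr sr' rp rp')

  BSTRots-between : ∀ {a b S W} → Spans a b S → Spans a b W → BSTRots (offRightSpine S + offRightSpine W) S W
  BSTRots-between {S = S} {W} sS sW with toRightPath S | toRightPath W
  ... | p , rp , S→p | p' , rp' , W→p'
    with RightPath-unique (Spans-BSTRots sS S→p) (Spans-BSTRots sW W→p') rp rp'
  ... | refl = S→p ◅◅ BSTRots-reverse W→p'

  data Consecutive : ℕ → List (Fin n) → Set where
    []  : ∀ {a} → Consecutive a []
    _∷_ : ∀ {a x xs} → toℕ x ≡ a → Consecutive (suc a) xs → Consecutive a (x ∷ xs)

  Consecutive-++⁻ : ∀ {a} xs {ys} → Consecutive a (xs ++ ys) → Consecutive a xs × Consecutive (a + length xs) ys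
  Consecutive-++⁻ {a} [] {ys} c = [] , subst (λ z → Consecutive z ys) (sym (+-identityʳ a)) c
  Consecutive-++⁻ {a} (x ∷ xs) {ys} (e ∷ c) with Consecutive-++⁻ xs c
  ... | c₁ , c₂ = e ∷ c₁ , subst (λ z → Consecutive z ys) (sym (+-suc a (length xs))) c₂

  Consecutive⇒Spans : ∀ t a → Consecutive a (inorder t) → Spans a (a + length (inorder t)) t
  Consecutive⇒Spans lf a c = subst (λ z → Spans a z lf) (sym (+-identityʳ a)) spans-lf
  Consecutive⇒Spans (br l k r) a c with Consecutive-++⁻ (inorder l) c
  ... | c₁ , e ∷ c₂ =
    spans-br (subst (λ z → Spans a z l) (sym e) (Consecutive⇒Spans l a c₁))
             (subst₂ (λ z z' → Spans z z' r) (cong suc (sym e)) end (Consecutive⇒Spans r _ c₂))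
    where
    L = length (inorder l)
    R = length (inorder r)
    end : suc (a + L) + R ≡ a + length (inorder l ++ k ∷ inorder r)
    end = trans (sym (+-suc (a + L) R)) (trans (+-assoc a L (suc R)) (cong (a +_) (sym (length-++ (inorder l)))))

  Consecutive-allFin : Consecutive 0 (allFin n)
  Consecutive-allFin = go 0 (λ i → i) (λ i → refl)
    where
    go : ∀ {N} a (f : Fin N → Fin n) → (∀ i → toℕ (f i) ≡ a + toℕ i) → Consecutive a (tabulate f)
    go {zero} a f h = []
    go {suc N} a f h = trans (h fzero) (+-identityʳ a) ∷ go (suc a) (λ i → f (fsuc i)) (λ i → trans (h (fsuc i)) (+-suc a (toℕ i)))

  IsBST⇒Spans : ∀ S → IsBST S → Spans 0 n S
  IsBST⇒Spans S bst = subst (λ z → Spans 0 z S) len (Consecutive⇒Spans S 0 (subst (Consecutive 0) (sym bst) Consecutive-allFin))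
    where
    len : length (inorder S) ≡ n
    len = trans (cong length bst) (length-tabulate (λ i → i))

module _ (w : ℕ → ℕ) where

  weight : ℕ → ℕ → ℕ
  weight a zero = 0
  weight a (suc len) = w a + weight (suc a) len

  weight-+ : ∀ a d l → weight a (d + l) ≡ weight a d + weight (a + d) l
  weight-+ a zero l = cong (λ z → weight z l) (sym (+-identityʳ a))
  weight-+ a (suc d) l = begin
    w a + weight (suc a) (d + l)                ≡⟨ cong (w a +_) (weight-+ (suc a) d l) ⟩
    w a + (weight (suc a) d + weight (suc a + d) l) ≡⟨ cong (λ z → w a + (weight (suc a) d + weight z l)) (sym (+-suc a d)) ⟩
    w a + (weight (suc a) d + weight (a + suc d) l) ≡⟨ +-assoc (w a) _ _ ⟨
    w a + weight (suc a) d + weight (a + suc d) l   ∎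
    where open ≡-Reasoning

  weight-tabulate : ∀ {N} a (f : Fin N → ℕ) → (∀ i → w (a + toℕ i) ≡ f i) → weight a N ≡ sum (tabulate f)
  weight-tabulate {zero} a f w≡f = refl
  weight-tabulate {suc N} a f w≡f =
    cong₂ _+_ (trans (cong w (sym (+-identityʳ a))) (w≡f fzero))
              (weight-tabulate (suc a) (f ∘ fsuc) (λ i → trans (cong w (sym (+-suc a (toℕ i)))) (w≡f (fsuc i))))

  -- Scanning d upwards while the prefix [a, a + d] stays within half the weight: at
  -- the first failure the suffix after position a + d is the lighter half.
  weightedMedian : ∀ a len → ∃₂ λ d e → d + suc e ≡ suc len × 2 * weight a d ≤ weight a (suc len)
                                        × 2 * weight (suc (a + d)) e ≤ weight a (suc len)
  weightedMedian a len = scan 0 len refl z≤n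
    where
    total = weight a (suc len)
    scan : ∀ d e → d + suc e ≡ suc len → 2 * weight a d ≤ total →
           ∃₂ λ d' e' → d' + suc e' ≡ suc len × 2 * weight a d' ≤ total × 2 * weight (suc (a + d')) e' ≤ total
    scan d zero eq h = d , 0 , eq , h , z≤n
    scan d (suc e) eq h with 2 * weight a (suc d) ≤? total
    ... | yes h' = scan (suc d) e (trans (sym (+-suc d (suc e))) eq) h'
    ... | no h' = d , suc e , eq , h , subst (2 * Y ≤_) (sym split) (lighter (subst (_< 2 * X) split (≰⇒> h')))
      where
      X = weight a (suc d)
      Y = weight (suc (a + d)) (suc e)
      split : total ≡ X + Y
      split = trans (cong (weight a) (trans (sym eq) (+-suc d (suc e))))
                    (trans (weight-+ a (suc d) (suc e)) (cong (λ z → X + weight z (suc e)) (+-suc a d)))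
      lighter : X + Y < 2 * X → 2 * Y ≤ X + Y
      lighter lt = subst (_≤ X + Y) (cong (Y +_) (sym (+-identityʳ Y)))
                         (+-monoˡ-≤ Y (<⇒≤ (+-cancelˡ-< X Y X (subst (X + Y <_) (cong (X +_) (+-identityʳ X)) lt))))

module _ {n : ℕ} (w : ℕ → ℕ) where

  -- The root splits [a, a + len) at a weighted median; fuel only makes the recursion structural.
  balancedBST : ∀ fuel len a → len ≤ fuel → a + len ≤ n →
                ∃ λ t → Spans a (a + len) t × (∀ (i : Fin n) → InRange a (a + len) i → 2 ^ depth (toℕ i) t * w (toℕ i) ≤ weight w a len)
  balancedBST fuel zero a _ _ =
    lf , subst (λ z → Spans {n} a z lf) (sym (+-identityʳ a)) spans-lf ,
    λ i r → ⊥-elim (InRange-empty (subst (λ z → InRange a z i) (+-identityʳ a) r))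
  balancedBST (suc fuel) (suc len) a (s≤s len≤fuel) a+len≤n with weightedMedian w a len
  ... | d , e , eq , left-light , right-light = br tl k tr , spans-br sl sr , balanced
    where
    d<len : d < suc len
    d<len = subst (d <_) eq (m<m+n d (s≤s z≤n))
    e<len : e < suc len
    e<len = subst (e <_) eq (m≤n+m (suc e) d)
    a+d<n : a + d < n
    a+d<n = <-≤-trans (+-monoʳ-< a d<len) a+len≤n
    k : Fin n
    k = fromℕ< a+d<n
    k≡ : toℕ k ≡ a + d
    k≡ = toℕ-fromℕ< a+d<n
    end : suc (a + d) + e ≡ a + suc len
    end = trans (cong suc (+-assoc a d e)) (trans (sym (+-suc a (d + e))) (cong (a +_) (trans (sym (+-suc d e)) eq)))
    recL = balancedBST fuel d a (≤-trans (≤-pred d<len) len≤fuel) (<⇒≤ a+d<n)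
    recR = balancedBST fuel e (suc (a + d)) (≤-trans (≤-pred e<len) len≤fuel) (subst (_≤ n) (sym end) a+len≤n)
    tl = proj₁ recL
    tr = proj₁ recR
    sl : Spans a (toℕ k) tl
    sl = subst (λ z → Spans a z tl) (sym k≡) (proj₁ (proj₂ recL))
    sr : Spans (suc (toℕ k)) (a + suc len) tr
    sr = subst₂ (λ z z' → Spans z z' tr) (cong suc (sym k≡)) end (proj₁ (proj₂ recR))
    root≤ : w (a + d) ≤ weight w a (suc len)
    root≤ = subst (w (a + d) ≤_) (sym (trans (cong (weight w a) (sym eq)) (weight-+ w a d (suc e))))
                  (≤-trans (m≤m+n (w (a + d)) _) (m≤n+m _ (weight w a d)))
    balanced : ∀ i → InRange a (a + suc len) i → 2 ^ depth (toℕ i) (br tl k tr) * w (toℕ i) ≤ weight w a (suc len)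
    balanced i (a≤i , i<end) with <-cmp (toℕ i) (toℕ k)
    ... | tri< i<k _ _ = ≤-trans (≤-reflexive (*-assoc 2 (2 ^ depth (toℕ i) tl) (w (toℕ i))))
                           (≤-trans (*-monoʳ-≤ 2 (proj₂ (proj₂ recL) i (a≤i , subst (toℕ i <_) k≡ i<k))) left-light)
    ... | tri≈ _ i≡k _ = subst (_≤ weight w a (suc len)) (trans (cong w (sym (trans i≡k k≡))) (sym (+-identityʳ (w (toℕ i))))) root≤
    ... | tri> _ _ k<i = ≤-trans (≤-reflexive (*-assoc 2 (2 ^ depth (toℕ i) tr) (w (toℕ i))))
                           (≤-trans (*-monoʳ-≤ 2 (proj₂ (proj₂ recR) i (subst (λ z → suc z ≤ toℕ i) k≡ k<i , subst (toℕ i <_) (sym end) i<end))) right-light)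

  weightBalancedBST : ∃ λ t → Spans 0 n t × (∀ (i : Fin n) → 2 ^ depth (toℕ i) t * w (toℕ i) ≤ weight w 0 n)
  weightBalancedBST with balancedBST n n 0 ≤-refl ≤-refl
  ... | t , s , balanced = t , s , λ i → balanced i (z≤n , toℕ<n i)

module Caterpillar (n : ℕ) (ms : Fin n → ℕ) where
  open Cat n ms

  Adj-sym : ∀ {u v} → Adj u v → Adj v u
  Adj-sym (ss e) = ss' e
  Adj-sym (ss' e) = ss e
  Adj-sym sl = ls
  Adj-sym ls = sl

  module _ {C : V → Set} where

    Conn-snoc : ∀ {u v w} → Conn C u v → Adj v w → C w → Conn C u w
    Conn-snoc here a cw = step a cw here
    Conn-snoc (step a′ cx p) a cw = step a′ cx (Conn-snoc p a cw)

    Conn-trans : ∀ {u v w} → Conn C u v → Conn C v w → Conn C u w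
    Conn-trans here q = q
    Conn-trans (step a cx p) q = step a cx (Conn-trans p q)

    Conn-sym : ∀ {u v} → C u → Conn C u v → Conn C v u
    Conn-sym cu here = here
    Conn-sym cu (step a cw p) = Conn-snoc (Conn-sym cw p) (Adj-sym a) cu

  data LegOf (k : Fin n) : V → Set where
    legOf : ∀ j → LegOf k (leg k j)

  legOf? : ∀ k v → Dec (LegOf k v)
  legOf? k (spine _) = no λ ()
  legOf? k (leg i j) with i ≟ᶠ k
  ... | yes refl = yes (legOf j)
  ... | no i≢k = no λ { (legOf _) → i≢k refl }

  legsAt : Fin n → List V → List V
  legsAt k = filter (legOf? k)

  data Owns (P : List V) (q : Fin n) : V → Set where
    ownsSpine : Owns P q (spine q)
    ownsLeg   : ∀ {j} → leg q j ∈ P → Owns P q (leg q j)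

  Owns-unique : ∀ {P q q' v} → Owns P q v → Owns P q' v → q ≡ q'
  Owns-unique ownsSpine ownsSpine = refl
  Owns-unique (ownsLeg _) (ownsLeg _) = refl

  ∈-legsAt⁻ : ∀ {k P v} → v ∈ legsAt k P → Owns P k v
  ∈-legsAt⁻ {k} {P} v∈ with ∈-filter⁻ (legOf? k) {xs = P} v∈
  ... | v∈P , legOf _ = ownsLeg v∈P

  ∈-legsAt⁺ : ∀ {k j P} → leg k j ∈ P → leg k j ∈ legsAt k P
  ∈-legsAt⁺ {k} {j} v∈P = ∈-filter⁺ (legOf? k) v∈P (legOf j)

  legsAt-LegOf : ∀ k P → All (LegOf k) (legsAt k P)
  legsAt-LegOf k P = All.tabulate λ v∈ → proj₂ (∈-filter⁻ (legOf? k) {xs = P} v∈)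

  hang : BT n → List V → List (RTree V)
  hang lf P = []
  hang (br l k r) P = [ node (spine k) (map leaf (legsAt k P) ++ hang l P ++ hang r P) ]

  hangNode : List V → BT n → Fin n → BT n → RTree V
  hangNode P l k r = node (spine k) (map leaf (legsAt k P) ++ hang l P ++ hang r P)

  bstTree≡hang : ∀ t → bstTree t ≡ hang t []
  bstTree≡hang lf = refl
  bstTree≡hang (br l k r) = cong (λ cs → [ node (spine k) cs ]) (cong₂ _++_ (bstTree≡hang l) (bstTree≡hang r))

  vertsF-children : ∀ P l k r → vertsF (map leaf (legsAt k P) ++ hang l P ++ hang r P)
                                ≡ legsAt k P ++ vertsF (hang l P) ++ vertsF (hang r P)
  vertsF-children P l k r =
    trans (vertsF-++ (map leaf (legsAt k P)) _) (cong₂ _++_ (vertsF-leaves (legsAt k P)) (vertsF-++ (hang l P) (hang r P)))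

  ∈-hangNode⁺ : ∀ {P l k r v} → v ∈ legsAt k P ++ vertsF (hang l P) ++ vertsF (hang r P) → v ∈ verts (hangNode P l k r)
  ∈-hangNode⁺ {P} {l} {k} {r} v∈ = there (subst (_ ∈_) (sym (vertsF-children P l k r)) v∈)

  ∈-hangNode⁻ : ∀ {P l k r v} → v ∈ verts (hangNode P l k r) → v ≡ spine k ⊎ v ∈ legsAt k P ++ vertsF (hang l P) ++ vertsF (hang r P)
  ∈-hangNode⁻ (here refl) = inj₁ refl
  ∈-hangNode⁻ {P} {l} {k} {r} (there v∈) = inj₂ (subst (_ ∈_) (vertsF-children P l k r) v∈)

  ∈-hang-left : ∀ {P l k r v} → v ∈ vertsF (hang l P) → v ∈ verts (hangNode P l k r)
  ∈-hang-left {P} {l} {k} {r} v∈ = ∈-hangNode⁺ {P} {l} {k} {r} (∈-++⁺ʳ (legsAt k P) (∈-++⁺ˡ v∈))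

  ∈-hang-right : ∀ {P l k r v} → v ∈ vertsF (hang r P) → v ∈ verts (hangNode P l k r)
  ∈-hang-right {P} {l} {k} {r} v∈ = ∈-hangNode⁺ {P} {l} {k} {r} (∈-++⁺ʳ (legsAt k P) (∈-++⁺ʳ (vertsF (hang l P)) v∈))

  ∈-hang⁻ : ∀ {a b t v} P → Spans a b t → v ∈ vertsF (hang t P) → ∃ λ q → InRange a b q × Owns P q v
  ∈-hang⁻ P (spans-br {l = l} {k} {r} sˡ sʳ) v∈ with ∈-hangNode⁻ {P} {l} {k} {r} (∈-vertsF-[]⁻ {x = hangNode P l k r} v∈)
  ... | inj₁ refl = k , InRange-root (spans-br sˡ sʳ) , ownsSpine
  ... | inj₂ v∈′ with ∈-++⁻ (legsAt k P) v∈′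
  ... | inj₁ v∈legs = k , InRange-root (spans-br sˡ sʳ) , ∈-legsAt⁻ v∈legs
  ... | inj₂ v∈′′ with ∈-++⁻ (vertsF (hang l P)) v∈′′
  ... | inj₁ v∈l = let q , q∈ , o = ∈-hang⁻ P sˡ v∈l in q , InRange-left (spans-br sˡ sʳ) q∈ , o
  ... | inj₂ v∈r = let q , q∈ , o = ∈-hang⁻ P sʳ v∈r in q , InRange-right (spans-br sˡ sʳ) q∈ , o

  ∈-hang⁺ : ∀ {a b t q v} P → Spans a b t → InRange a b q → Owns P q v → v ∈ vertsF (hang t P)
  ∈-hang⁺ P spans-lf q∈ _ = ⊥-elim (InRange-empty q∈)
  ∈-hang⁺ {q = q} P (spans-br {l = l} {k} {r} sˡ sʳ) (a≤q , q<b) o with <-cmp (toℕ q) (toℕ k)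
  ... | tri< q<k _ _ = ∈-vertsF-[]⁺ {x = hangNode P l k r} (∈-hang-left {P} {l} {k} {r} (∈-hang⁺ P sˡ (a≤q , q<k) o))
  ... | tri> _ _ k<q = ∈-vertsF-[]⁺ {x = hangNode P l k r} (∈-hang-right {P} {l} {k} {r} (∈-hang⁺ P sʳ (k<q , q<b) o))
  ... | tri≈ _ q≡k _ with toℕ-injective q≡k | o
  ... | refl | ownsSpine = here refl
  ... | refl | ownsLeg v∈P = ∈-vertsF-[]⁺ {x = hangNode P l k r} (∈-hangNode⁺ {P} {l} {k} {r} (∈-++⁺ˡ (∈-legsAt⁺ v∈P)))

  Owns-Adj-spine : ∀ {P q v y} → Owns P q v → Adj v (spine y) → toℕ y ≤ suc (toℕ q) × toℕ q ≤ suc (toℕ y)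
  Owns-Adj-spine ownsSpine (ss e) = ≤-reflexive e , ≤-trans (n≤1+n _) (≤-trans (≤-reflexive (sym e)) (n≤1+n _))
  Owns-Adj-spine ownsSpine (ss' e) = ≤-trans (n≤1+n _) (≤-trans (≤-reflexive (sym e)) (n≤1+n _)) , ≤-reflexive e
  Owns-Adj-spine (ownsLeg _) ls = n≤1+n _ , n≤1+n _

  hang-¬Touches-spine : ∀ {a b t} P y → Spans a b t → b < toℕ y ⊎ suc (toℕ y) < a →
                        All (λ c → ¬ Touches (spine y) c) (hang t P)
  hang-¬Touches-spine P y s far = All.tabulate λ c∈ (v , v∈c , adj) →
    let q , (a≤q , q<b) , o = ∈-hang⁻ P s (∈-vertsF⁺ c∈ v∈c)
        y≤1+q , q≤1+y = Owns-Adj-spine o adj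
    in [ (λ b<y → <-irrefl refl (≤-<-trans (≤-trans y≤1+q q<b) b<y))
       , (λ 1+y<a → <-irrefl refl (≤-<-trans q≤1+y (<-≤-trans 1+y<a a≤q))) ]′ far

  hang-¬Touches-leg : ∀ {a b t} P i j → Spans a b t → ¬ InRange a b i → All (λ c → ¬ Touches (leg i j) c) (hang t P)
  hang-¬Touches-leg P i j s i∉ = All.tabulate λ c∈ (v , v∈c , adj) → owner-in-range (∈-hang⁻ P s (∈-vertsF⁺ c∈ v∈c)) adj
    where
    owner-in-range : ∀ {v} → ∃ (λ q → InRange _ _ q × Owns P q v) → ¬ Adj v (leg i j)
    owner-in-range (_ , i∈ , ownsSpine) sl = i∉ i∈
    owner-in-range (_ , _ , ownsLeg _) ()

  legLeaves-¬Touches-leg : ∀ k P i j → All (λ c → ¬ Touches (leg i j) c) (map leaf (legsAt k P))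
  legLeaves-¬Touches-leg k P i j = AllP.map⁺ (All.map (λ { (legOf _) (_ , here refl , ()) }) (legsAt-LegOf k P))

  leftmostSpine : ∀ {a b l k r} P → Spans a b (br l k r) → ∃ λ q → toℕ q ≡ a × spine q ∈ verts (hangNode P l k r)
  leftmostSpine P (spans-br {l = lf} {k} spans-lf _) = k , refl , here refl
  leftmostSpine P (spans-br {l = br l₁ k₁ r₁} {k} {r} sˡ _) =
    let q , q≡a , q∈ = leftmostSpine P sˡ
    in q , q≡a , ∈-hang-left {P} {br l₁ k₁ r₁} {k} {r} (∈-vertsF-[]⁺ {x = hangNode P l₁ k₁ r₁} q∈)

  rightmostSpine : ∀ {a b l k r} P → Spans a b (br l k r) → ∃ λ q → suc (toℕ q) ≡ b × spine q ∈ verts (hangNode P l k r)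
  rightmostSpine P (spans-br {k = k} {r = lf} _ spans-lf) = k , refl , here refl
  rightmostSpine P (spans-br {l = l} {k} {br l₁ k₁ r₁} _ sʳ) =
    let q , 1+q≡b , q∈ = rightmostSpine P sʳ
    in q , 1+q≡b , ∈-hang-right {P} {l} {k} {br l₁ k₁ r₁} (∈-vertsF-[]⁺ {x = hangNode P l₁ k₁ r₁} q∈)

  hang-Touches-successor : ∀ {b t} P x → Spans (suc (toℕ x)) b t → All (Touches (spine x)) (hang t P)
  hang-Touches-successor P x spans-lf = []
  hang-Touches-successor P x s@(spans-br _ _) = let q , q≡ , q∈ = leftmostSpine P s in (spine q , q∈ , ss' q≡) ∷ []

  hang-Touches-predecessor : ∀ {a t} P y → Spans a (toℕ y) t → All (Touches (spine y)) (hang t P)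
  hang-Touches-predecessor P y spans-lf = []
  hang-Touches-predecessor P y s@(spans-br _ _) = let q , q≡ , q∈ = rightmostSpine P s in (spine q , q∈ , ss (sym q≡)) ∷ []

  BSTRot-lift : ∀ {a b l k r l' k' r'} → Spans a b (br l k r) → BSTRot (br l k r) (br l' k' r') →
                Rot (hangNode [] l k r) (hangNode [] l' k' r')
  BSTRot-lift (spans-br (spans-br sa sb) sc) (rotateRight {a = A} {b = B} {y = y} {c = C}) =
    top {pre = []} {post = hang C []} {moved = hang B []} {stay = hang A []}
        (++-comm (hang A []) (hang B []))
        (hang-Touches-predecessor [] y sb)
        (hang-¬Touches-spine [] y sa (inj₁ (Spans⇒≤ sb)))
        ↭-refl
        (↭-sym (∷↭∷ʳ _ (hang A [])))
  BSTRot-lift (spans-br sa (spans-br sb sc)) (rotateLeft {a = A} {x = x} {b = B}) =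
    top {pre = hang A []} {post = []} {moved = hang B []}
        ↭-refl
        (hang-Touches-successor [] x sb)
        (hang-¬Touches-spine [] x sc (inj₂ (s≤s (Spans⇒≤ sb))))
        (↭-reflexive (cong (hang A [] ++_) (sym (++-identityʳ (hang B [])))))
        ↭-refl
  BSTRot-lift _ (inLeft {l = lf} ())
  BSTRot-lift _ (inLeft {l = br _ _ _} {l' = lf} ())
  BSTRot-lift _ (inRight {r = lf} ())
  BSTRot-lift _ (inRight {r = br _ _ _} {r' = lf} ())
  BSTRot-lift (spans-br sˡ _) (inLeft {l = br _ _ _} {l' = br _ _ _} {r = r} p) = down {pre = []} {post = hang r []} (BSTRot-lift sˡ p)
  BSTRot-lift (spans-br _ sʳ) (inRight {l = l} {r = br _ _ _} {r' = br _ _ _} p) = down {pre = hang l []} {post = []} (BSTRot-lift sʳ p)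

  Rots-++ : ∀ {k k' t u w} → Rots k t u → Rots k' u w → Rots (k + k') t w
  Rots-++ done qs = qs
  Rots-++ (more p ps) qs = more p (Rots-++ ps qs)

  Rots-down : ∀ {k r pre post t t'} → Rots k t t' → Rots k (node r (pre ++ t ∷ post)) (node r (pre ++ t' ∷ post))
  Rots-down done = done
  Rots-down (more p ps) = more (down p) (Rots-down ps)

  BSTRots-lift : ∀ {a b m l k r l' k' r'} → Spans a b (br l k r) → BSTRots m (br l k r) (br l' k' r') →
                 Rots m (hangNode [] l k r) (hangNode [] l' k' r')
  BSTRots-lift s ε = done
  BSTRots-lift s (_◅_ {u = br _ _ _} p ps) = more (BSTRot-lift s p) (BSTRots-lift (Spans-BSTRot s p) ps)

  onTop : List V → RTree V → RTree V
  onTop [] x = x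
  onTop (v ∷ vs) x = onTop vs (node v [ x ])

  legPath-onTop : ∀ vs x → legPath vs [ x ] ≡ [ onTop vs x ]
  legPath-onTop [] x = refl
  legPath-onTop (v ∷ vs) x = legPath-onTop vs (node v [ x ])

  Rot-onTop : ∀ vs {x x'} → Rot x x' → Rot (onTop vs x) (onTop vs x')
  Rot-onTop [] p = p
  Rot-onTop (v ∷ vs) p = Rot-onTop vs (down {pre = []} {post = []} p)

  Rots-onTop : ∀ vs {k x x'} → Rots k x x' → Rots k (onTop vs x) (onTop vs x')
  Rots-onTop vs done = done
  Rots-onTop vs (more p ps) = more (Rot-onTop vs p) (Rots-onTop vs ps)

  rotateSpine : ∀ {S W π T} → 1 ≤ n → Spans 0 n S → Spans 0 n W → A S π ≡ [ T ] →
                ∃ λ y → hang W [] ≡ [ y ] × Rots (offRightSpine S + offRightSpine W) T (onTop π y)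
  rotateSpine {lf} 1≤n sS _ _ = ⊥-elim (<⇒≢ 1≤n (Spans-lf⇒≡ sS))
  rotateSpine {br _ _ _} {lf} 1≤n _ sW _ = ⊥-elim (<⇒≢ 1≤n (Spans-lf⇒≡ sW))
  rotateSpine {br l k r} {br l' k' r'} {π} _ sS sW A≡T =
    hangNode [] l' k' r' , refl ,
    subst (λ T → Rots _ T (onTop π (hangNode [] l' k' r'))) T≡ (Rots-onTop π (BSTRots-lift sS (BSTRots-between sS sW)))
    where
    T≡ : onTop π (hangNode [] l k r) ≡ _
    T≡ = ∷-injectiveˡ (trans (sym (trans (cong (legPath π) (bstTree≡hang (br l k r))) (legPath-onTop π _))) A≡T)

  legsAt-same : ∀ {i j} P → legsAt i (leg i j ∷ P) ≡ leg i j ∷ legsAt i P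
  legsAt-same {i} {j} P = filter-accept (legOf? i) {leg i j} {P} (legOf j)

  legsAt-other : ∀ {i j k} P → i ≢ k → legsAt k (leg i j ∷ P) ≡ legsAt k P
  legsAt-other {i} {j} {k} P i≢k = filter-reject (legOf? k) {leg i j} {P} λ { (legOf _) → i≢k refl }

  hang-irrelevant : ∀ {a b t} P i j → Spans a b t → ¬ InRange a b i → hang t (leg i j ∷ P) ≡ hang t P
  hang-irrelevant P i j spans-lf _ = refl
  hang-irrelevant P i j s@(spans-br {l = l} {k} {r} sˡ sʳ) i∉ =
    cong (λ cs → [ node (spine k) cs ])
      (cong₂ _++_ (cong (map leaf) (legsAt-other P i≢k))
                  (cong₂ _++_ (hang-irrelevant P i j sˡ (i∉ ∘ InRange-left s))
                              (hang-irrelevant P i j sʳ (i∉ ∘ InRange-right s))))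
    where
    i≢k : i ≢ k
    i≢k refl = i∉ (InRange-root s)

  pushLegDown : ∀ {a b t} P i j → Spans a b t → InRange a b i →
                ∃ λ y → hang t (leg i j ∷ P) ≡ [ y ] × Rots (suc (depth (toℕ i) t)) (node (leg i j) (hang t P)) y
  pushLegDown P i j spans-lf i∈ = ⊥-elim (InRange-empty i∈)
  pushLegDown P i j s@(spans-br {l = l} {k} {r} sˡ sʳ) (a≤i , i<b) with <-cmp (toℕ i) (toℕ k)
  ... | tri≈ _ i≡k _ with toℕ-injective i≡k
  ... | refl =
      node (spine i) (leaf (leg i j) ∷ cs)
    , cong (λ cs → [ node (spine i) cs ])
        (cong₂ _++_ (cong (map leaf) (legsAt-same P))
                    (cong₂ _++_ (hang-irrelevant P i j sˡ i∉l) (hang-irrelevant P i j sʳ i∉r)))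
    , more (top {pre = []} {post = []} {moved = []} {ps' = []} ↭-refl [] ¬touch ↭-refl ↭-refl) done
    where
    i∉l : ¬ InRange _ (toℕ i) i
    i∉l (_ , i<i) = <-irrefl refl i<i
    i∉r : ¬ InRange (suc (toℕ i)) _ i
    i∉r (i<i , _) = <-irrefl refl i<i
    cs = map leaf (legsAt i P) ++ hang l P ++ hang r P
    ¬touch : All (λ c → ¬ Touches (leg i j) c) cs
    ¬touch = AllP.++⁺ (legLeaves-¬Touches-leg i P i j)
                      (AllP.++⁺ (hang-¬Touches-leg P i j sˡ i∉l) (hang-¬Touches-leg P i j sʳ i∉r))
  pushLegDown P i j s@(spans-br {l = l} {k} {r} sˡ sʳ) (a≤i , i<b) | tri< i<k _ _ with l | sˡ
  ... | lf | sˡ′ = ⊥-elim (InRange-lf sˡ′ (a≤i , i<k))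
  ... | br l₁ k₁ r₁ | sˡ′ with pushLegDown P i j sˡ′ (a≤i , i<k)
  ... | y , y≡ , rots =
      node (spine k) (Ls ++ y ∷ R)
    , cong (λ cs → [ node (spine k) cs ])
        (cong₂ _++_ (cong (map leaf) (legsAt-other P i≢k)) (cong₂ _++_ y≡ (hang-irrelevant P i j sʳ i∉r)))
    , more (top {pre = []} {post = []} {moved = [ Lt ]} {stay = Ls ++ R}
             (shift Lt Ls R)
             ((spine i , ∈-vertsF-[]⁻ {x = Lt} (∈-hang⁺ P sˡ′ (a≤i , i<k) ownsSpine) , sl) ∷ [])
             (AllP.++⁺ (legLeaves-¬Touches-leg k P i j) (hang-¬Touches-leg P i j sʳ i∉r))
             ↭-refl
             (shift (node (leg i j) [ Lt ]) Ls R))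
           (Rots-down {pre = Ls} {post = R} rots)
    where
    Ls = map leaf (legsAt k P)
    R = hang r P
    Lt = hangNode P l₁ k₁ r₁
    i≢k : i ≢ k
    i≢k refl = <-irrefl refl i<k
    i∉r : ¬ InRange (suc (toℕ k)) _ i
    i∉r (k<i , _) = <-asym i<k k<i
  pushLegDown P i j s@(spans-br {l = l} {k} {r} sˡ sʳ) (a≤i , i<b) | tri> _ _ k<i with r | sʳ
  ... | lf | sʳ′ = ⊥-elim (InRange-lf sʳ′ (k<i , i<b))
  ... | br l₁ k₁ r₁ | sʳ′ with pushLegDown P i j sʳ′ (k<i , i<b)
  ... | y , y≡ , rots =
      node (spine k) ((Ls ++ L) ++ [ y ])
    , cong (λ cs → [ node (spine k) cs ])
        (trans (cong₂ _++_ (cong (map leaf) (legsAt-other P i≢k)) (cong₂ _++_ (hang-irrelevant P i j sˡ i∉l) y≡))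
               (sym (++-assoc Ls L [ y ])))
    , more (top {pre = []} {post = []} {moved = [ Rt ]} {stay = Ls ++ L}
             (↭-trans (↭-reflexive (sym (++-assoc Ls L [ Rt ]))) (↭-sym (∷↭∷ʳ Rt (Ls ++ L))))
             ((spine i , ∈-vertsF-[]⁻ {x = Rt} (∈-hang⁺ P sʳ′ (k<i , i<b) ownsSpine) , sl) ∷ [])
             (AllP.++⁺ (legLeaves-¬Touches-leg k P i j) (hang-¬Touches-leg P i j sˡ i∉l))
             ↭-refl
             (↭-sym (∷↭∷ʳ (node (leg i j) [ Rt ]) (Ls ++ L))))
           (Rots-down {pre = Ls ++ L} {post = []} rots)
    where
    Ls = map leaf (legsAt k P)
    L = hang l P
    Rt = hangNode P l₁ k₁ r₁
    i≢k : i ≢ k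
    i≢k refl = <-irrefl refl k<i
    i∉l : ¬ InRange _ (toℕ k) i
    i∉l (_ , i<k) = <-asym i<k k<i

  data IsLeg : V → Set where
    isLeg : ∀ {i j} → IsLeg (leg i j)

  legCost : BT n → V → ℕ
  legCost W (spine _) = 0
  legCost W (leg i _) = suc (depth (toℕ i) W)

  pushLegsDown : ∀ {W} → Spans 0 n W → ∀ xs {P y} → hang W P ≡ [ y ] → All IsLeg xs →
                 ∃ λ y' → hang W (xs ʳ++ P) ≡ [ y' ] × Rots (sum (map (legCost W) xs)) (onTop xs y) y'
  pushLegsDown s [] W≡y [] = _ , W≡y , done
  pushLegsDown s (leg i j ∷ xs) {P} W≡y (isLeg ∷ legs) with pushLegDown P i j s (z≤n , toℕ<n i)
  ... | y₁ , W≡y₁ , rots₁ with pushLegsDown s xs W≡y₁ legs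
  ... | y' , W≡y' , rots' =
    y' , W≡y' , Rots-++ (Rots-onTop xs (subst (λ cs → Rots _ (node (leg i j) cs) y₁) W≡y rots₁)) rots'

  hangNode-connected : ∀ {a b l k r} P → Spans a b (br l k r) → ∀ u v →
                       u ∈ verts (hangNode P l k r) → v ∈ verts (hangNode P l k r) → Conn (_∈ verts (hangNode P l k r)) u v
  hangNode-connected {a} {b} {l} {k} {r} P s u v u∈ v∈ = Conn-trans (toLeftmost u u∈) (Conn-sym v∈ (toLeftmost v v∈))
    where
    X = hangNode P l k r
    C : V → Set
    C w = w ∈ verts X
    q₀ = proj₁ (leftmostSpine P s)
    q₀≡a : toℕ q₀ ≡ a
    q₀≡a = proj₁ (proj₂ (leftmostSpine P s))
    spine∈X : ∀ {q} → InRange a b q → C (spine q)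
    spine∈X q∈ = ∈-vertsF-[]⁻ {x = X} (∈-hang⁺ P s q∈ ownsSpine)
    walk : ∀ d q → toℕ q ≡ a + d → toℕ q < b → Conn C (spine q) (spine q₀)
    walk zero q q≡ _ with toℕ-injective {i = q} {j = q₀} (trans q≡ (trans (+-identityʳ a) (sym q₀≡a)))
    ... | refl = here
    walk (suc d) q q≡ q<b = step (ss' q≡1+q′) (spine∈X q′∈) (walk d q′ q′≡ (proj₂ q′∈))
      where
      a+d<q : a + d < toℕ q
      a+d<q = ≤-reflexive (sym (trans q≡ (+-suc a d)))
      q′ = fromℕ< (<-trans a+d<q (toℕ<n q))
      q′≡ : toℕ q′ ≡ a + d
      q′≡ = toℕ-fromℕ< _
      q′∈ : InRange a b q′
      q′∈ = subst (a ≤_) (sym q′≡) (m≤m+n a d) , subst (_< b) (sym q′≡) (<-trans a+d<q q<b)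
      q≡1+q′ : toℕ q ≡ suc (toℕ q′)
      q≡1+q′ = trans q≡ (trans (+-suc a d) (cong suc (sym q′≡)))
    toLeftmost : ∀ w → C w → Conn C w (spine q₀)
    toLeftmost w w∈ with ∈-hang⁻ P s (∈-vertsF-[]⁺ {x = X} w∈)
    ... | q , (a≤q , q<b) , ownsSpine = walk (toℕ q ∸ a) q (sym (m+[n∸m]≡n a≤q)) q<b
    ... | q , (a≤q , q<b) , ownsLeg _ = step ls (spine∈X (a≤q , q<b)) (walk (toℕ q ∸ a) q (sym (m+[n∸m]≡n a≤q)) q<b)

  hangNode-IsComponent : ∀ {a b l k r} P (U : V → Set) → Spans a b (br l k r) →
                         (∀ v → v ∈ verts (hangNode P l k r) → U v) →
                         (∀ {i j} → U (leg i j) → leg i j ∈ P) →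
                         (∀ {q q'} → InRange a b q → Adj (spine q) (spine q') → U (spine q') → InRange a b q') →
                         IsComponent U (_∈ verts (hangNode P l k r))
  hangNode-IsComponent {l = l} {k} {r} P U s X⊆U U-leg U-spine = X⊆U , (spine k , here refl) , hangNode-connected P s , closed
    where
    X = hangNode P l k r
    closed : ∀ u v → u ∈ verts X → U v → Adj u v → v ∈ verts X
    closed u v u∈ Uv adj with ∈-hang⁻ P s (∈-vertsF-[]⁺ {x = X} u∈)
    closed _ (spine _) _ Uv adj | _ , q∈ , ownsSpine = ∈-vertsF-[]⁻ {x = X} (∈-hang⁺ P s (U-spine q∈ adj Uv) ownsSpine)
    closed _ (leg _ _) _ Uv sl | _ , q∈ , ownsSpine = ∈-vertsF-[]⁻ {x = X} (∈-hang⁺ P s q∈ (ownsLeg (U-leg Uv)))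
    closed _ _ _ _ ls | _ , q∈ , ownsLeg _ = ∈-vertsF-[]⁻ {x = X} (∈-hang⁺ P s q∈ ownsSpine)

  hang-IsComponents : ∀ {a b t} P (U : V → Set) → Spans a b t →
                      (∀ v → v ∈ vertsF (hang t P) → U v) →
                      (∀ {i j} → U (leg i j) → leg i j ∈ P) →
                      (∀ {q q'} → InRange a b q → Adj (spine q) (spine q') → U (spine q') → InRange a b q') →
                      All (λ c → IsComponent U (_∈ verts c)) (hang t P)
  hang-IsComponents P U spans-lf _ _ _ = []
  hang-IsComponents P U s@(spans-br {l = l} {k} {r} _ _) t⊆U U-leg U-spine =
    hangNode-IsComponent P U s (λ v v∈ → t⊆U v (∈-vertsF-[]⁺ {x = hangNode P l k r} v∈)) U-leg U-spine ∷ []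

  leaf-IsComponent : ∀ (U : V → Set) v → U v → (∀ w → Adj v w → ¬ U w) → IsComponent U (_∈ verts (leaf v))
  leaf-IsComponent U v Uv isolated = (λ { _ (here refl) → Uv }) , (v , here refl) , (λ { _ _ (here refl) (here refl) → here }) ,
                                     λ { _ w (here refl) Uw adj → ⊥-elim (isolated w adj Uw) }

  hang-AllPairs : ∀ {a b t} P {R : RTree V → RTree V → Set} → Spans a b t → AllPairs R (hang t P)
  hang-AllPairs P spans-lf = []
  hang-AllPairs P (spans-br _ _) = [] ∷ []

  hang-Disjoint : ∀ {a₁ b₁ t₁ a₂ b₂ t₂} P → Spans a₁ b₁ t₁ → Spans a₂ b₂ t₂ → b₁ ≤ a₂ →
                  All (λ x → All (Disjoint x) (hang t₂ P)) (hang t₁ P)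
  hang-Disjoint P s₁ s₂ b₁≤a₂ = All.tabulate λ x∈ → All.tabulate λ y∈ v v∈x v∈y →
    let q₁ , (_ , q₁<b₁) , o₁ = ∈-hang⁻ P s₁ (∈-vertsF⁺ x∈ v∈x)
        q₂ , (a₂≤q₂ , _) , o₂ = ∈-hang⁻ P s₂ (∈-vertsF⁺ y∈ v∈y)
    in <-irrefl (cong toℕ (Owns-unique o₁ o₂)) (<-≤-trans q₁<b₁ (≤-trans b₁≤a₂ a₂≤q₂))

  legLeaves-Disjoint : ∀ {a b t} P k → Spans a b t → ¬ InRange a b k →
                       All (λ x → All (Disjoint x) (hang t P)) (map leaf (legsAt k P))
  legLeaves-Disjoint P k s k∉ = AllP.map⁺ (All.tabulate λ v∈ → All.tabulate λ y∈ → λ { _ (here refl) w∈y →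
    let q , q∈ , o = ∈-hang⁻ P s (∈-vertsF⁺ y∈ w∈y)
    in k∉ (subst (InRange _ _) (sym (Owns-unique (∈-legsAt⁻ v∈) o)) q∈) })

  hang-IsST : ∀ {a b t} P → Unique P → Spans a b t → All IsST (hang t P)
  hang-IsST P P! spans-lf = []
  hang-IsST P P! s@(spans-br {a} {b} {l} {k} {r} sˡ sʳ) =
    st (AllP.++⁺ leaves-components
                 (AllP.++⁺ (hang-IsComponents P U sˡ (λ v v∈ → ∈-hang-left {P} {l} {k} {r} v∈ , notRoot sˡ k∉l v∈) U-leg closeL)
                           (hang-IsComponents P U sʳ (λ v v∈ → ∈-hang-right {P} {l} {k} {r} v∈ , notRoot sʳ k∉r v∈) U-leg closeR)))
       (AllPairsP.++⁺ leaves-distinct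
                      (AllPairsP.++⁺ (hang-AllPairs P sˡ) (hang-AllPairs P sʳ) (hang-Disjoint P sˡ sʳ (n≤1+n _)))
                      (All.zipWith (λ (x , y) → AllP.++⁺ x y) (legLeaves-Disjoint P k sˡ k∉l , legLeaves-Disjoint P k sʳ k∉r)))
       (AllP.++⁺ (AllP.map⁺ (All.universal (λ _ → st [] [] []) (legsAt k P))) (AllP.++⁺ (hang-IsST P P! sˡ) (hang-IsST P P! sʳ)))
    ∷ []
    where
    X = hangNode P l k r
    U : V → Set
    U v = v ∈ verts X × v ≢ spine k
    U-leg : ∀ {i j} → U (leg i j) → leg i j ∈ P
    U-leg (v∈ , _) with ∈-hang⁻ P s (∈-vertsF-[]⁺ {x = X} v∈)
    ... | _ , _ , ownsLeg v∈P = v∈P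
    U-range : ∀ {q} → U (spine q) → InRange a b q
    U-range (v∈ , _) with ∈-hang⁻ P s (∈-vertsF-[]⁺ {x = X} v∈)
    ... | _ , q∈ , ownsSpine = q∈
    U-≢ : ∀ {q} → U (spine q) → toℕ q ≢ toℕ k
    U-≢ (_ , q≢k) eq = q≢k (cong spine (toℕ-injective eq))
    k∉l : ¬ InRange a (toℕ k) k
    k∉l (_ , k<k) = <-irrefl refl k<k
    k∉r : ¬ InRange (suc (toℕ k)) b k
    k∉r (k<k , _) = <-irrefl refl k<k
    notRoot : ∀ {a′ b′ t v} → Spans a′ b′ t → ¬ InRange a′ b′ k → v ∈ vertsF (hang t P) → v ≢ spine k
    notRoot s′ k∉ v∈ refl with ∈-hang⁻ P s′ v∈
    ... | _ , k∈ , ownsSpine = k∉ k∈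
    closeL : ∀ {q q'} → InRange a (toℕ k) q → Adj (spine q) (spine q') → U (spine q') → InRange a (toℕ k) q'
    closeL (_ , q<k) (ss e) Uq′ = proj₁ (U-range Uq′) , ≤∧≢⇒< (subst (_≤ toℕ k) (sym e) q<k) (U-≢ Uq′)
    closeL (_ , q<k) (ss' e) Uq′ = proj₁ (U-range Uq′) , <-trans (≤-reflexive (sym e)) q<k
    closeR : ∀ {q q'} → InRange (suc (toℕ k)) b q → Adj (spine q) (spine q') → U (spine q') → InRange (suc (toℕ k)) b q'
    closeR (k<q , _) (ss e) Uq′ = ≤-trans k<q (≤-trans (n≤1+n _) (≤-reflexive (sym e))) , proj₂ (U-range Uq′)
    closeR (k<q , _) (ss' e) Uq′ = ≤∧≢⇒< (≤-pred (subst (suc (toℕ k) ≤_) e k<q)) (U-≢ Uq′ ∘ sym) , proj₂ (U-range Uq′)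
    legLeaf-component : ∀ {v} → v ∈ legsAt k P → LegOf k v → IsComponent U (_∈ verts (leaf v))
    legLeaf-component v∈ (legOf _) =
      leaf-IsComponent U _ (∈-hangNode⁺ {P} {l} {k} {r} (∈-++⁺ˡ v∈) , λ ()) λ { _ ls (_ , k≢k) → k≢k refl }
    leaves-components : All (λ c → IsComponent U (_∈ verts c)) (map leaf (legsAt k P))
    leaves-components = AllP.map⁺ (All.tabulate λ v∈ → legLeaf-component v∈ (All.lookup (legsAt-LegOf k P) v∈))
    leaves-distinct : AllPairs Disjoint (map leaf (legsAt k P))
    leaves-distinct = AllPairsP.map⁺ (AllPairs.map (λ v≢w → λ { _ (here refl) (here refl) → v≢w refl })
                                                   (UniqueP.filter⁺ (legOf? k) P!))

  hang-NoFree : ∀ t P → All NoFree (hang t P)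
  hang-NoFree lf P = []
  hang-NoFree (br l k r) P =
    spineN (AllP.++⁺ (AllP.map⁺ (All.map (λ { (legOf _) → legN }) (legsAt-LegOf k P)))
                     (AllP.++⁺ (hang-NoFree l P) (hang-NoFree r P))) ∷ []

  hang-covers : ∀ {W P} → Spans 0 n W → (∀ i j → leg i j ∈ P) → ∀ v → v ∈ vertsF (hang W P)
  hang-covers s legs∈P (spine q) = ∈-hang⁺ _ s (z≤n , toℕ<n q) ownsSpine
  hang-covers s legs∈P (leg i j) = ∈-hang⁺ _ s (z≤n , toℕ<n i) (ownsLeg (legs∈P i j))

  legsOf : Fin n → List V
  legsOf i = map (leg i) (allFin (ms i))

  allLegs-Unique : Unique allLegs
  allLegs-Unique =
    UniqueP.concat⁺ (AllP.map⁺ (All.universal (λ i → UniqueP.map⁺ leg-injective (UniqueP.allFin⁺ (ms i))) (allFin n)))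
                    (AllPairsP.map⁺ (AllPairs.map legsOf-disjoint (UniqueP.allFin⁺ n)))
    where
    leg-injective : ∀ {i} {j j′ : Fin (ms i)} → leg i j ≡ leg i j′ → j ≡ j′
    leg-injective refl = refl
    legsOf-disjoint : ∀ {i i′} → i ≢ i′ → ∀ {v} → ¬ (v ∈ legsOf i × v ∈ legsOf i′)
    legsOf-disjoint i≢i′ (v∈ , v∈′) with ∈-map⁻ (leg _) v∈ | ∈-map⁻ (leg _) v∈′
    ... | _ , _ , refl | _ , _ , refl = i≢i′ refl

  ∈-allLegs⁻ : ∀ {v} → v ∈ allLegs → IsLeg v
  ∈-allLegs⁻ v∈ with Any.satisfied (∈-concatMap⁻ legsOf {xs = allFin n} v∈)
  ... | i , v∈i with ∈-map⁻ (leg i) v∈i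
  ... | _ , _ , refl = isLeg

  ∈-allLegs⁺ : ∀ i j → leg i j ∈ allLegs
  ∈-allLegs⁺ i j = ∈-concatMap⁺ legsOf {xs = allFin n} (Any.map (λ { refl → ∈-map⁺ (leg i) (∈-allFin j) }) (∈-allFin i))

  sum-map-const : ∀ {X : Set} (xs : List X) c → sum (map (λ _ → c) xs) ≡ length xs * c
  sum-map-const [] c = refl
  sum-map-const (x ∷ xs) c = cong (c +_) (sum-map-const xs c)

  sum-legCost : ∀ W is → sum (map (legCost W) (concatMap legsOf is)) ≡ sum (map (λ i → ms i * suc (depth (toℕ i) W)) is)
  sum-legCost W [] = refl
  sum-legCost W (i ∷ is) = begin
    sum (map (legCost W) (legsOf i ++ concatMap legsOf is))                ≡⟨ cong sum (map-++ (legCost W) (legsOf i) _) ⟩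
    sum (map (legCost W) (legsOf i) ++ map (legCost W) (concatMap legsOf is)) ≡⟨ sum-++ (map (legCost W) (legsOf i)) _ ⟩
    sum (map (legCost W) (legsOf i)) + sum (map (legCost W) (concatMap legsOf is))
      ≡⟨ cong₂ _+_ (trans (cong sum (sym (map-∘ (allFin (ms i))))) (sum-map-const (allFin (ms i)) _)) (sum-legCost W is) ⟩
    length (allFin (ms i)) * c + sum (map (λ i → ms i * suc (depth (toℕ i) W)) is)
      ≡⟨ cong (λ z → z * c + sum (map (λ i → ms i * suc (depth (toℕ i) W)) is)) (length-tabulate {n = ms i} (λ j → j)) ⟩
    ms i * c + sum (map (λ i → ms i * suc (depth (toℕ i) W)) is) ∎
    where
    open ≡-Reasoning
    c = suc (depth (toℕ i) W)

  -- ms extended by 0 beyond n, so that weights of ℕ-intervals make sense.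
  legWeight : ℕ → ℕ
  legWeight q with q <? n
  ... | yes q<n = ms (fromℕ< q<n)
  ... | no _ = 0

  legWeight-toℕ : ∀ i → legWeight (toℕ i) ≡ ms i
  legWeight-toℕ i with toℕ i <? n
  ... | yes i<n = cong ms (fromℕ<-toℕ i i<n)
  ... | no i≮n = ⊥-elim (i≮n (toℕ<n i))

  balancedSpine : ∃ λ W → Spans 0 n W × (∀ i → 2 ^ depth (toℕ i) W * ms i ≤ m)
  balancedSpine with weightBalancedBST {n} legWeight
  ... | W , s , balanced = W , s , λ i → subst₂ (λ x y → 2 ^ depth (toℕ i) W * x ≤ y) (legWeight-toℕ i) total (balanced i)
    where
    total : weight legWeight 0 n ≡ m
    total = trans (weight-tabulate legWeight 0 ms legWeight-toℕ) (sym (cong sum (map-tabulate (λ i → i) ms)))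

  -- The entropy bound Σ m_i d_i ≤ Σ m_i log₂ (m / m_i) in multiplicative form:
  -- 2^(Σ m_i d_i) Π m_i^m_i = Π (2^d_i m_i)^m_i ≤ Π m^m_i.
  entropyBound : ∀ (D : Fin n → ℕ) → (∀ i → 2 ^ D i * ms i ≤ m) → ∀ is →
                 2 ^ sum (map (λ i → ms i * D i) is) * product (map (λ i → ms i ^ ms i) is) ≤ m ^ sum (map ms is)
  entropyBound D D-bound [] = ≤-refl
  entropyBound D D-bound (i ∷ is) = begin
    2 ^ (a * d + S) * (a ^ a * Π)            ≡⟨ cong (_* (a ^ a * Π)) (^-distribˡ-+-* 2 (a * d) S) ⟩
    (2 ^ (a * d) * 2 ^ S) * (a ^ a * Π)      ≡⟨ interchange (2 ^ (a * d)) (2 ^ S) (a ^ a) Π ⟩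
    (2 ^ (a * d) * a ^ a) * (2 ^ S * Π)      ≡⟨ cong (λ z → (z * a ^ a) * (2 ^ S * Π)) (trans (cong (2 ^_) (*-comm a d)) (sym (^-*-assoc 2 d a))) ⟩
    ((2 ^ d) ^ a * a ^ a) * (2 ^ S * Π)      ≡⟨ cong (_* (2 ^ S * Π)) (sym (^-distribʳ-* (2 ^ d) a a)) ⟩
    (2 ^ d * a) ^ a * (2 ^ S * Π)            ≤⟨ *-mono-≤ (^-monoˡ-≤ a (D-bound i)) (entropyBound D D-bound is) ⟩
    m ^ a * m ^ sum (map ms is)              ≡⟨ ^-distribˡ-+-* m a (sum (map ms is)) ⟨
    m ^ (a + sum (map ms is))                ∎
    where
    open ≤-Reasoning
    a = ms i
    d = D i
    S = sum (map (λ i → ms i * D i) is)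
    Π = product (map (λ i → ms i ^ ms i) is)
    interchange : ∀ w x y z → (w * x) * (y * z) ≡ (w * y) * (x * z)
    interchange = solve-∀

  product-^-double : ∀ is → product (map (λ i → ms i ^ (2 * ms i)) is)
                            ≡ product (map (λ i → ms i ^ ms i) is) * product (map (λ i → ms i ^ ms i) is)
  product-^-double [] = refl
  product-^-double (i ∷ is) =
    trans (cong₂ _*_ (trans (cong (ms i ^_) (cong (ms i +_) (+-identityʳ (ms i)))) (^-distribˡ-+-* (ms i) (ms i) (ms i)))
                     (product-^-double is))
          (interchange (ms i ^ ms i) (ms i ^ ms i) _ _)
    where
    interchange : ∀ w x y z → (w * x) * (y * z) ≡ (w * y) * (x * z)
    interchange = solve-∀

  withinBound : ∀ (D : Fin n → ℕ) → (∀ i → 2 ^ D i * ms i ≤ m) → ∀ o₁ o₂ → o₁ ≤ n → o₂ ≤ n →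
                WithinBound 2 (o₁ + o₂ + sum (map (λ i → ms i * suc (D i)) (allFin n)))
  withinBound D D-bound o₁ o₂ o₁≤n o₂≤n = begin
    2 ^ (o₁ + o₂ + sum (map (λ i → ms i * suc (D i)) (allFin n))) * Π²
      ≤⟨ *-monoˡ-≤ Π² (^-monoʳ-≤ 2 (+-mono-≤ (+-mono-≤ o₁≤n o₂≤n) (≤-reflexive (sum-split (allFin n))))) ⟩
    2 ^ ((n + n) + (m + SD)) * Π²
      ≡⟨ cong₂ _*_ (trans (^-distribˡ-+-* 2 (n + n) (m + SD)) (cong (2 ^ (n + n) *_) (^-distribˡ-+-* 2 m SD)))
                   (product-^-double (allFin n)) ⟩
    (2 ^ (n + n) * (2 ^ m * 2 ^ SD)) * (Π * Π)
      ≡⟨ regroup (2 ^ (n + n)) (2 ^ m) (2 ^ SD) Π ⟩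
    (2 ^ (n + n) * 2 ^ m) * ((2 ^ SD * Π) * Π)
      ≤⟨ *-monoʳ-≤ (2 ^ (n + n) * 2 ^ m) (*-mono-≤ entropy Π≤m^m) ⟩
    (2 ^ (n + n) * 2 ^ m) * (m ^ m * m ^ m)
      ≡⟨ cong₂ _*_ (^-distribˡ-+-* 2 (n + n) m) (^-distribˡ-+-* m m m) ⟨
    2 ^ ((n + n) + m) * m ^ (m + m)
      ≤⟨ *-mono-≤ (^-monoʳ-≤ 2 exponent) (≤-reflexive (cong (λ z → m ^ (m + z)) (sym (+-identityʳ m)))) ⟩
    2 ^ (2 * (n + m)) * m ^ (2 * m)
      ∎
    where
    open ≤-Reasoning
    SD = sum (map (λ i → ms i * D i) (allFin n))
    Π = product (map (λ i → ms i ^ ms i) (allFin n))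
    Π² = product (map (λ i → ms i ^ (2 * ms i)) (allFin n))
    sum-split : ∀ is → sum (map (λ i → ms i * suc (D i)) is) ≡ sum (map ms is) + sum (map (λ i → ms i * D i) is)
    sum-split [] = refl
    sum-split (i ∷ is) = trans (cong₂ _+_ (*-suc (ms i) (D i)) (sum-split is)) (+-+-interchange (ms i) (ms i * D i) _ _)
      where
      +-+-interchange : ∀ w x y z → (w + x) + (y + z) ≡ (w + y) + (x + z)
      +-+-interchange = solve-∀
    entropy : 2 ^ SD * Π ≤ m ^ m
    entropy = entropyBound D D-bound (allFin n)
    Π≤m^m : Π ≤ m ^ m
    Π≤m^m = ≤-trans (≤-trans (≤-reflexive (sym (*-identityˡ Π))) (*-monoˡ-≤ Π (m^n>0 2 SD))) entropy
    regroup : ∀ x y z p → (x * (y * z)) * (p * p) ≡ (x * y) * ((z * p) * p)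
    regroup = solve-∀
    exponent : (n + n) + m ≤ 2 * (n + m)
    exponent = ≤-trans (+-monoʳ-≤ (n + n) (m≤m+n m m)) (≤-reflexive (double n m))
      where
      double : ∀ a b → (a + a) + (b + b) ≡ 2 * (a + b)
      double = solve-∀

  totalCost-withinBound : ∀ {S W : BT n} {π} → Spans 0 n S → Spans 0 n W → (∀ i → 2 ^ depth (toℕ i) W * ms i ≤ m) → π ↭ allLegs →
                          WithinBound 2 (offRightSpine S + offRightSpine W + sum (map (legCost W) π))
  totalCost-withinBound {S} {W} {π} sS sW W-balanced π↭legs =
    subst (λ c → WithinBound 2 (offRightSpine S + offRightSpine W + c)) (sym legCost≡)
          (withinBound (λ i → depth (toℕ i) W) W-balanced _ _ (offRightSpine-≤ sS) (offRightSpine-≤ sW))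
    where
    legCost≡ : sum (map (legCost W) π) ≡ sum (map (λ i → ms i * suc (depth (toℕ i) W)) (allFin n))
    legCost≡ = trans (sum-↭ (PermP.map⁺ (legCost W) π↭legs)) (sum-legCost W (allFin n))

  hungLegs-IsSTG : ∀ {W π y} → Spans 0 n W → π ↭ allLegs → hang W (reverse π) ≡ [ y ] → IsSTG y
  hungLegs-IsSTG {W} {π} s π↭legs W≡y =
      All.head (subst (All IsST) W≡y (hang-IsST _ (PermSetoid.Unique-resp-↭ (setoid V) (↭⇒↭ₛ (↭-sym rev↭legs)) allLegs-Unique) s))
    , λ v → ∈-vertsF-[]⁻ (subst (λ ts → v ∈ vertsF ts) W≡y (hang-covers s (λ i j → ∈-resp-↭ (↭-sym rev↭legs) (∈-allLegs⁺ i j)) v))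
    where
    rev↭legs : reverse π ↭ allLegs
    rev↭legs = ↭-trans (PermP.↭-reverse π) π↭legs

  hungLegs-NoFree : ∀ {W P y} → hang W P ≡ [ y ] → NoFree y
  hungLegs-NoFree {W} {P} W≡y = All.head (subst (All NoFree) W≡y (hang-NoFree W P))

lemma9 : Σ ℕ λ c → 1 ≤ c ×
    ((n : ℕ) → 1 ≤ n → (ms : Fin n → ℕ) →
    (S : BT n) → IsBST S →
    (π : List (Cat.V n ms)) → π ↭ Cat.allLegs n ms →
    (T : RTree (Cat.V n ms)) → Cat.A n ms S π ≡ [ T ] →
    ∃ λ k → ∃ λ T' →
    Cat.WithinBound n ms c k × Cat.Rots n ms k T T' ×
    Cat.IsSTG n ms T' × Cat.NoFree n ms T')
lemma9 = 2 , s≤s z≤n , λ n 1≤n ms S S-bst π π↭legs T A≡T →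
  let open Caterpillar n ms
      S-spans = IsBST⇒Spans S S-bst
      W , W-spans , W-balanced = balancedSpine
      y , W≡y , spineRots = rotateSpine {π = π} 1≤n S-spans W-spans A≡T
      π-legs = All.tabulate (λ v∈π → ∈-allLegs⁻ (∈-resp-↭ π↭legs v∈π))
      y′ , W≡y′ , legRots = pushLegsDown W-spans π W≡y π-legs
  in _ , y′ , totalCost-withinBound S-spans W-spans W-balanced π↭legs , Rots-++ spineRots legRots ,
     hungLegs-IsSTG W-spans π↭legs W≡y′ , hungLegs-NoFree W≡y′
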